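{- Let $a,b,n$ be positive integers such that $a\le b$, $a\equiv b\pmod 2$, and $na$ is even. Then the graph $H_{n,a}=K_{a-1}\nabla (K_1\cup K_{n-a})$ has no $(a,b)$-parity factor.
   Context: All graphs are finite, simple and undirected. For positive integers $a\le b$ with $a\equiv b\pmod 2$, an $(a,b)$-parity factor of $G$ is a spanning subgraph $F$ of $G$ such that $d_F(v)\equiv b \pmod 2$ and $a\le d_F(v)\le b$ for every vertex $v$. $K_s$ is the complete graph on $s$ vertices ($K_0$ is the empty graph), $\cup$ is vertex-disjoint union, and the join $G_1\nabla G_2$ is obtained from $G_1\cup G_2$ by adding all edges between $G_1$ and $G_2$. -}

module Defs where

open import Data.Nat using (ℕ; zero; suc; _+_; _*_; _∸_; _≤_; _%_)
open import Data.Bool using (Bool; true; false; not; if_then_else_)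
open import Data.Fin using (Fin; splitAt)
open import Data.Fin.Properties using (_≟_)
open import Data.Sum using (_⊎_; inj₁; inj₂)
open import Data.List using (List; map; allFin)
open import Data.Nat.ListAction using (sum)
open import Data.Product using (_×_)
open import Relation.Nullary.Decidable using (⌊_⌋; yes; no)
open import Data.Empty using (⊥-elim)
open import Relation.Binary.PropositionalEquality using (_≡_; refl; sym)

record Graph (n : ℕ) : Set where
  field
    adj    : Fin n → Fin n → Bool
    adj-sym    : ∀ u v → adj u v ≡ adj v u
    adj-irrefl : ∀ v → adj v v ≡ false
open Graph public

K : (s : ℕ) → Graph s
K s = record { adj = λ u v → not ⌊ u ≟ v ⌋ ; adj-sym = symK ; adj-irrefl = irrK }
  where
  symK : ∀ (u v : Fin s) → not ⌊ u ≟ v ⌋ ≡ not ⌊ v ≟ u ⌋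
  symK u v with u ≟ v | v ≟ u
  ... | yes _ | yes _ = refl
  ... | no _  | no _  = refl
  ... | yes p | no q  = ⊥-elim (q (sym p))
  ... | no q  | yes p = ⊥-elim (q (sym p))
  irrK : ∀ (v : Fin s) → not ⌊ v ≟ v ⌋ ≡ false
  irrK v with v ≟ v
  ... | yes _ = refl
  ... | no q  = ⊥-elim (q refl)

combine : ∀ {m k} → Bool → Graph m → Graph k → Graph (m + k)
combine {m} {k} c G H = record { adj = A ; adj-sym = S ; adj-irrefl = I }
  where
  A' : Fin m ⊎ Fin k → Fin m ⊎ Fin k → Bool
  A' (inj₁ x) (inj₁ y) = adj G x y
  A' (inj₂ x) (inj₂ y) = adj H x y
  A' (inj₁ _) (inj₂ _) = c
  A' (inj₂ _) (inj₁ _) = c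
  A : Fin (m + k) → Fin (m + k) → Bool
  A u v = A' (splitAt m u) (splitAt m v)
  S' : ∀ x y → A' x y ≡ A' y x
  S' (inj₁ x) (inj₁ y) = adj-sym G x y
  S' (inj₂ x) (inj₂ y) = adj-sym H x y
  S' (inj₁ _) (inj₂ _) = refl
  S' (inj₂ _) (inj₁ _) = refl
  S : ∀ u v → A u v ≡ A v u
  S u v = S' (splitAt m u) (splitAt m v)
  I' : ∀ x → A' x x ≡ false
  I' (inj₁ x) = adj-irrefl G x
  I' (inj₂ x) = adj-irrefl H x
  I : ∀ v → A v v ≡ false
  I v = I' (splitAt m v)

_∪ᴳ_ : ∀ {m k} → Graph m → Graph k → Graph (m + k)
G ∪ᴳ H = combine false G H

_∇_ : ∀ {m k} → Graph m → Graph k → Graph (m + k)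
G ∇ H = combine true G H

infixr 5 _∇_
infixr 6 _∪ᴳ_

Hna : (n a : ℕ) → Graph ((a ∸ 1) + (1 + (n ∸ a)))
Hna n a = K (a ∸ 1) ∇ (K 1 ∪ᴳ K (n ∸ a))

record SpanningSubgraph {n : ℕ} (G : Graph n) : Set where
  field
    sel     : Fin n → Fin n → Bool
    sel-sym : ∀ u v → sel u v ≡ sel v u
    sel-sub : ∀ u v → sel u v ≡ true → adj G u v ≡ true
open SpanningSubgraph public

degree : ∀ {n} {G : Graph n} → SpanningSubgraph G → Fin n → ℕ
degree {n} F v = sum (map (λ u → if sel F v u then 1 else 0) (allFin n))

IsParityFactor : ∀ {n} {G : Graph n} → ℕ → ℕ → SpanningSubgraph G → Set
IsParityFactor {n} a b F =
  ∀ (v : Fin n) → (degree F v % 2 ≡ b % 2) × (a ≤ degree F v) × (degree F v ≤ b)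

record ParityFactor {n : ℕ} (a b : ℕ) (G : Graph n) : Set where
  field
    factor : SpanningSubgraph G
    isPF   : IsParityFactor a b factor

-- The K₁ vertex of H_{n,a} is adjacent only to the a − 1 vertices of K_{a−1}. A spanning
-- subgraph can only use edges of the host graph, so that vertex has degree at most a − 1
-- in every spanning subgraph, and no factor can have minimum degree a.
module Submission where

open import Defs
open import Data.Nat using (ℕ; zero; suc; _+_; _*_; _∸_; _≤_; _%_; z≤n; s≤s)
open import Data.Nat.Properties using (1+n≰n; ≤-trans; +-mono-≤)
open import Data.Fin using (Fin; _↑ʳ_) renaming (zero to fzero; suc to fsuc)
open import Data.Fin.Properties using (splitAt-↑ʳ)
open import Data.Bool using (Bool; true; false; if_then_else_)
open import Data.List using (tabulate)
open import Data.List.Properties using (map-tabulate)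
open import Data.Nat.ListAction using (sum)
open import Data.Product using (proj₁; proj₂)
open import Relation.Binary.PropositionalEquality using (_≡_; refl; sym; trans)
open import Relation.Nullary using (¬_)
open import Function using (id)

Isolated : ∀ {k} → Graph k → Fin k → Set
Isolated H y = ∀ x → adj H y x ≡ false

K₁∪ᴳ-isolated : ∀ {k} (H : Graph k) → Isolated (K 1 ∪ᴳ H) fzero
K₁∪ᴳ-isolated H fzero    = refl
K₁∪ᴳ-isolated H (fsuc x) = refl

∇-adj-↑ʳ : ∀ {m k} (G : Graph m) (H : Graph k) (y x : Fin k) →
           adj (G ∇ H) (m ↑ʳ y) (m ↑ʳ x) ≡ adj H y x
∇-adj-↑ʳ {m} {k} G H y x rewrite splitAt-↑ʳ m k y | splitAt-↑ʳ m k x = refl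

indicator≤1 : (c : Bool) → (if c then 1 else 0) ≤ 1
indicator≤1 true  = s≤s z≤n
indicator≤1 false = z≤n

sum-tabulate-zero : ∀ k (h : Fin k → ℕ) → (∀ x → h x ≡ 0) → sum (tabulate h) ≡ 0
sum-tabulate-zero zero    h h≡0 = refl
sum-tabulate-zero (suc k) h h≡0
  rewrite h≡0 fzero = sum-tabulate-zero k (λ x → h (fsuc x)) (λ x → h≡0 (fsuc x))

sum-tabulate-≤-prefix : ∀ m k (h : Fin (m + k) → ℕ) → (∀ u → h u ≤ 1) →
                        (∀ x → h (m ↑ʳ x) ≡ 0) → sum (tabulate h) ≤ m
sum-tabulate-≤-prefix zero    k h h≤1 h≡0 rewrite sum-tabulate-zero k h h≡0 = z≤n
sum-tabulate-≤-prefix (suc m) k h h≤1 h≡0 =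
  +-mono-≤ (h≤1 fzero)
           (sum-tabulate-≤-prefix m k (λ u → h (fsuc u)) (λ u → h≤1 (fsuc u)) h≡0)

sel-nonadjacent : ∀ {n} {G : Graph n} (F : SpanningSubgraph G) {u v : Fin n} →
                  adj G u v ≡ false → sel F u v ≡ false
sel-nonadjacent F {u} {v} u≁v with sel F u v in e
... | false = refl
... | true with trans (sym (sel-sub F u v e)) u≁v
...   | ()

degree-≤-prefix : ∀ {m k} {G : Graph (m + k)} (F : SpanningSubgraph G) (v : Fin (m + k)) →
                  (∀ x → adj G v (m ↑ʳ x) ≡ false) → degree F v ≤ m
degree-≤-prefix {m} {k} F v v≁suffix
  rewrite map-tabulate id (λ u → if sel F v u then 1 else 0) =
  sum-tabulate-≤-prefix m k _ (λ u → indicator≤1 (sel F v u)) no-edge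
  where
  no-edge : ∀ x → (if sel F v (m ↑ʳ x) then 1 else 0) ≡ 0
  no-edge x rewrite sel-nonadjacent F (v≁suffix x) = refl

degree-∇-isolated-≤ : ∀ {m k} (G : Graph m) {H : Graph k} {y : Fin k} → Isolated H y →
                      (F : SpanningSubgraph (G ∇ H)) → degree F (m ↑ʳ y) ≤ m
degree-∇-isolated-≤ G {H} {y} iso F =
  degree-≤-prefix F _ (λ x → trans (∇-adj-↑ʳ G H y x) (iso x))

lemma2p3 : (a b n : ℕ) → 1 ≤ a → 1 ≤ b → 1 ≤ n → a ≤ b → a % 2 ≡ b % 2 →
    (n * a) % 2 ≡ 0 → a ≤ n → ¬ ParityFactor a b (Hna n a)
lemma2p3 (suc a') b n (s≤s z≤n) _ _ _ _ _ _ pf = 1+n≰n (≤-trans a≤degree degree≤a')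
  where
  open ParityFactor pf
  w : Fin (a' + (1 + (n ∸ suc a')))
  w = a' ↑ʳ fzero
  a≤degree : suc a' ≤ degree factor w
  a≤degree = proj₁ (proj₂ (isPF w))
  degree≤a' : degree factor w ≤ a'
  degree≤a' = degree-∇-isolated-≤ (K a') (K₁∪ᴳ-isolated (K (n ∸ suc a'))) factor
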